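{- For any $\epsilon>0$ and any positive integer $r$, there exist a graph $G$ with $\Delta(G)=r$ and a tree $T$, each with $n$ vertices (for some $n$), such that $3\Delta(G)+\ell(T)-2<(1+\epsilon)n$, but $G$ and $T$ do not pack.
   Context: For graphs $G$ and $H$ with $|V(G)|\ge |V(H)|$, $G$ and $H$ pack if there is an injective map $f:V(H)\to V(G)$ such that $f(x)f(y)\notin E(G)$ for every edge $xy\in E(H)$. $\Delta(G)$ denotes the maximum degree of $G$ and $\ell(T)$ the number of vertices of degree $1$ in $T$. -}

module Defs where

open import Data.Nat using (ℕ; zero; suc; _+_; _≤_)
open import Data.Bool using (Bool; true; false; if_then_else_)
open import Data.Fin using (Fin)
open import Data.List using (List; []; _∷_; length; map; allFin)
open import Data.Nat.ListAction using (sum)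
open import Data.List.Relation.Unary.Unique.Propositional using (Unique)
open import Data.Product using (Σ; _×_; ∃; ∃-syntax)
open import Relation.Binary.PropositionalEquality using (_≡_)
open import Relation.Nullary using (¬_)
open import Function.Definitions using (Injective)

record Graph (n : ℕ) : Set where
  field
    Adj   : Fin n → Fin n → Bool
    sym   : ∀ u v → Adj u v ≡ Adj v u
    irrefl : ∀ v → Adj v v ≡ false
open Graph public

Edge : ∀ {n} → Graph n → Fin n → Fin n → Set
Edge G u v = Adj G u v ≡ true

degree : ∀ {n} → Graph n → Fin n → ℕ
degree {n} G v = sum (map (λ u → if Adj G v u then 1 else 0) (allFin n))

MaxDegreeIs : ∀ {n} → Graph n → ℕ → Set
MaxDegreeIs {n} G r = (∀ v → degree G v ≤ r) × ∃[ v ] degree G v ≡ r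

data Walk {n} (G : Graph n) : Fin n → Fin n → Set where
  here : ∀ {u} → Walk G u u
  step : ∀ {u w v} → Edge G u w → Walk G w v → Walk G u v

Connected : ∀ {n} → Graph n → Set
Connected G = ∀ u v → Walk G u v

data PathFromTo {n} (G : Graph n) : Fin n → List (Fin n) → Fin n → Set where
  single : ∀ {v} → PathFromTo G v (v ∷ []) v
  cons   : ∀ {u w v vs} → Edge G u w → PathFromTo G w (w ∷ vs) v →
           PathFromTo G u (u ∷ w ∷ vs) v

HasCycle : ∀ {n} → Graph n → Set
HasCycle {n} G = Σ (List (Fin n)) λ vs → Σ (Fin n) λ a → Σ (Fin n) λ b →
  (3 ≤ length vs) × Unique vs × PathFromTo G a vs b × Edge G b a

IsTree : ∀ {n} → Graph n → Set
IsTree {n} T = (1 ≤ n) × Connected T × ¬ HasCycle T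

leaves : ∀ {n} → Graph n → ℕ
leaves {n} T = sum (map (λ v → if isOne (degree T v) then 1 else 0) (allFin n))
  where
  isOne : ℕ → Bool
  isOne (suc zero) = true
  isOne _ = false

Pack : ∀ {n m} → Graph n → Graph m → Set
Pack {n} {m} G H = (m ≤ n) × Σ (Fin m → Fin n) λ f →
  Injective _≡_ _≡_ f × (∀ x y → Edge H x y → Adj G (f x) (f y) ≡ false)

module Submission where

-- Let G be the disjoint union of cliques K_{r+1} on n vertices and T the star K_{1,n-1}.
-- G is r-regular with r ≥ 1, so it has no isolated vertex; but in a packing the centre
-- of the star must go to a vertex adjacent to none of the other n − 1 vertices.  As
-- ℓ(T) ≤ n, the inequality only needs 3r ≤ εn, which holds once n ≥ 3r·q for ε = p/q.

open import Defs hiding (sym)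
open import Data.Nat using (ℕ; _+_; _*_; _≤_)
open import Data.Integer using (+_)
open import Data.Rational using (ℚ; 0ℚ; 1ℚ; _/_; _<_; _-_)
open import Data.Product using (Σ; _×_)
open import Relation.Nullary using (¬_)

open import Data.Nat as ℕ using (zero; suc; _≡ᵇ_; NonZero; z≤n; s≤s)
open import Data.Nat.DivMod using (m<n⇒m/n≡0; m<n*o⇒m/o<n; +-distrib-/-∣ˡ; n/n≡1)
open import Data.Nat.Divisibility using (∣-refl)
import Data.Nat.Properties as ℕP
open import Data.Nat.Coprimality using (1-coprimeTo) renaming (sym to coprime-sym)
open import Data.Nat.ListAction using (sum)
open import Data.Integer as ℤ using (+[1+_]; -[1+_])
import Data.Integer.Properties as ℤP
open import Data.Rational as Q using (mkℚ; toℚᵘ; ↧ₙ_; *<*)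
import Data.Rational.Properties as QP
open import Data.Rational.Unnormalised as U using (mkℚᵘ)
import Data.Rational.Unnormalised.Properties as UP
open import Data.Bool using (Bool; true; false; if_then_else_; _∧_; not)
open import Data.Bool.Properties using (∧-identityʳ; ∧-zeroʳ)
open import Data.Fin as F using (Fin; toℕ)
import Data.Fin.Properties as FP
open import Data.List using ([]; _∷_; length; map; allFin; tabulate)
import Data.List.Properties as LP
open import Data.List.Relation.Unary.All using (_∷_)
open import Data.List.Relation.Unary.AllPairs using (_∷_)
open import Data.Product using (_,_; ∃-syntax)
open import Data.Sum using (_⊎_; inj₁; inj₂)
open import Function.Base using (_∘_; id)
open import Relation.Nullary using (contradiction)
open import Relation.Binary.PropositionalEquality

indicator : Bool → ℕ
indicator b = if b then 1 else 0

count : (ℕ → Bool) → ℕ → ℕ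
count p zero    = 0
count p (suc n) = indicator (p 0) + count (p ∘ suc) n

sum-indicator-allFin : ∀ (p : ℕ → Bool) n →
  sum (map (λ u → indicator (p (toℕ u))) (allFin n)) ≡ count p n
sum-indicator-allFin p n =
  trans (cong sum (LP.map-tabulate {n = n} id (λ u → indicator (p (toℕ u))))) (sum-tabulate p n)
  where
  sum-tabulate : ∀ (p : ℕ → Bool) n →
    sum (tabulate {n = n} (λ u → indicator (p (toℕ u)))) ≡ count p n
  sum-tabulate p zero    = refl
  sum-tabulate p (suc n) = cong (_+_ (indicator (p 0))) (sum-tabulate (p ∘ suc) n)

count-cong : ∀ {p q : ℕ → Bool} n → (∀ u → u ℕ.< n → p u ≡ q u) → count p n ≡ count q n
count-cong zero    eq = refl
count-cong (suc n) eq = cong₂ (λ b c → indicator b + c) (eq 0 (s≤s z≤n))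
                                (count-cong n (λ u u<n → eq (suc u) (s≤s u<n)))

count-true : ∀ n → count (λ _ → true) n ≡ n
count-true zero    = refl
count-true (suc n) = cong suc (count-true n)

count-false : ∀ n → count (λ _ → false) n ≡ 0
count-false zero    = refl
count-false (suc n) = count-false n

count-+ : ∀ (p : ℕ → Bool) m n → count p (m + n) ≡ count p m + count (λ u → p (m + u)) n
count-+ p zero    n = refl
count-+ p (suc m) n = trans (cong (_+_ (indicator (p 0))) (count-+ (p ∘ suc) m n))
                            (sym (ℕP.+-assoc (indicator (p 0)) (count (p ∘ suc) m) _))

≡ᵇ-sym : ∀ m n → (m ≡ᵇ n) ≡ (n ≡ᵇ m)
≡ᵇ-sym zero    zero    = refl
≡ᵇ-sym zero    (suc n) = refl
≡ᵇ-sym (suc m) zero    = refl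
≡ᵇ-sym (suc m) (suc n) = ≡ᵇ-sym m n

≡ᵇ-refl : ∀ n → (n ≡ᵇ n) ≡ true
≡ᵇ-refl zero    = refl
≡ᵇ-refl (suc n) = ≡ᵇ-refl n

count-remove : ∀ (p : ℕ → Bool) {v} n → p v ≡ true → v ℕ.< n →
  suc (count (λ u → p u ∧ not (v ≡ᵇ u)) n) ≡ count p n
count-remove p {zero}  (suc n) pv _ rewrite pv =
  cong suc (count-cong n (λ u _ → ∧-identityʳ (p (suc u))))
count-remove p {suc v} (suc n) pv (s≤s v<n) rewrite ∧-identityʳ (p 0) =
  trans (sym (ℕP.+-suc _ _)) (cong (_+_ (indicator (p 0))) (count-remove (p ∘ suc) n pv v<n))

count-block : ∀ d .{{_ : NonZero d}} {q} k → q ℕ.< k →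
  count (λ u → q ≡ᵇ u ℕ./ d) (k * d) ≡ d
count-block d {q} (suc k) q<k = begin
  count (λ u → q ≡ᵇ u ℕ./ d) (d + k * d)
    ≡⟨ count-+ _ d (k * d) ⟩
  count (λ u → q ≡ᵇ u ℕ./ d) d + count (λ u → q ≡ᵇ (d + u) ℕ./ d) (k * d)
    ≡⟨ cong₂ _+_ (count-cong d (λ u u<d → cong (q ≡ᵇ_) (m<n⇒m/n≡0 u<d)))
                 (count-cong (k * d) (λ u _ → cong (q ≡ᵇ_) ([d+u]/d≡1+u/d u))) ⟩
  count (λ _ → q ≡ᵇ 0) d + count (λ u → q ≡ᵇ suc (u ℕ./ d)) (k * d)
    ≡⟨ first-or-later-block q q<k ⟩
  d ∎
  where
  open ≡-Reasoning
  [d+u]/d≡1+u/d : ∀ u → (d + u) ℕ./ d ≡ suc (u ℕ./ d)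
  [d+u]/d≡1+u/d u = trans (+-distrib-/-∣ˡ u (∣-refl {d})) (cong (_+ u ℕ./ d) (n/n≡1 d))
  first-or-later-block : ∀ q → q ℕ.< suc k →
    count (λ _ → q ≡ᵇ 0) d + count (λ u → q ≡ᵇ suc (u ℕ./ d)) (k * d) ≡ d
  first-or-later-block zero    _         =
    trans (cong₂ _+_ (count-true d) (count-false (k * d))) (ℕP.+-identityʳ d)
  first-or-later-block (suc q) (s≤s q<k) =
    trans (cong (_+ count (λ u → q ≡ᵇ u ℕ./ d) (k * d)) (count-false d)) (count-block d k q<k)

-- Vertex u lies in block ⌊u/d⌋, so each block is a clique K_d (the last one smaller if d ∤ n).
blockCliques : (d n : ℕ) .{{_ : NonZero d}} → Graph n
blockCliques d n = record
  { Adj    = λ u v → sameBlockDistinct (toℕ u) (toℕ v)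
  ; sym    = λ u v → sameBlockDistinct-sym (toℕ u) (toℕ v)
  ; irrefl = λ v → sameBlockDistinct-irrefl (toℕ v)
  }
  where
  sameBlockDistinct : ℕ → ℕ → Bool
  sameBlockDistinct u v = (u ℕ./ d ≡ᵇ v ℕ./ d) ∧ not (u ≡ᵇ v)
  sameBlockDistinct-sym : ∀ u v → sameBlockDistinct u v ≡ sameBlockDistinct v u
  sameBlockDistinct-sym u v = cong₂ (λ b c → b ∧ not c) (≡ᵇ-sym (u ℕ./ d) (v ℕ./ d)) (≡ᵇ-sym u v)
  sameBlockDistinct-irrefl : ∀ u → sameBlockDistinct u u ≡ false
  sameBlockDistinct-irrefl u = trans (cong (λ b → (u ℕ./ d ≡ᵇ u ℕ./ d) ∧ not b) (≡ᵇ-refl u)) (∧-zeroʳ _)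

blockCliques-regular : ∀ k r (v : Fin (k * suc r)) → degree (blockCliques (suc r) (k * suc r)) v ≡ r
blockCliques-regular k r v = ℕP.suc-injective (begin
  suc (degree (blockCliques (suc r) (k * suc r)) v)
    ≡⟨ cong suc (sum-indicator-allFin (λ u → sameBlock u ∧ not (toℕ v ≡ᵇ u)) (k * suc r)) ⟩
  suc (count (λ u → sameBlock u ∧ not (toℕ v ≡ᵇ u)) (k * suc r))
    ≡⟨ count-remove sameBlock (k * suc r) (≡ᵇ-refl (toℕ v ℕ./ suc r)) (FP.toℕ<n v) ⟩
  count sameBlock (k * suc r)
    ≡⟨ count-block (suc r) k (m<n*o⇒m/o<n (FP.toℕ<n v)) ⟩
  suc r ∎)
  where
  open ≡-Reasoning
  sameBlock : ℕ → Bool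
  sameBlock u = toℕ v ℕ./ suc r ≡ᵇ u ℕ./ suc r

indicator≤1 : ∀ b → indicator b ≤ 1
indicator≤1 true  = ℕP.≤-refl
indicator≤1 false = z≤n

sum-map≤length : ∀ {A : Set} (g : A → ℕ) xs → (∀ x → g x ≤ 1) → sum (map g xs) ≤ length xs
sum-map≤length g []       _   = z≤n
sum-map≤length g (x ∷ xs) g≤1 = ℕP.+-mono-≤ (g≤1 x) (sum-map≤length g xs g≤1)

leaves≤ : ∀ {n} (T : Graph n) → leaves T ≤ n
leaves≤ {n} T = ℕP.≤-trans (sum-map≤length _ (allFin n) (λ v → indicator≤1 _))
                           (ℕP.≤-reflexive (LP.length-tabulate {n = n} id))

sum-indicator-pos : ∀ {A : Set} (p : A → Bool) xs →
  0 ℕ.< sum (map (λ x → indicator (p x)) xs) → ∃[ x ] p x ≡ true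
sum-indicator-pos p (x ∷ xs) pos with p x in px
... | true  = x , px
... | false = sum-indicator-pos p xs pos

degree-pos⇒neighbour : ∀ {n} (G : Graph n) v → 0 ℕ.< degree G v → ∃[ u ] Edge G v u
degree-pos⇒neighbour {n} G v = sum-indicator-pos (Adj G v) (allFin n)

starAdj : ∀ {n} → Fin n → Fin n → Bool
starAdj F.zero    F.zero    = false
starAdj F.zero    (F.suc _) = true
starAdj (F.suc _) F.zero    = true
starAdj (F.suc _) (F.suc _) = false

Star : ∀ n → Graph n
Star n = record { Adj = starAdj ; sym = starAdj-sym ; irrefl = starAdj-irrefl }
  where
  starAdj-sym : ∀ (u v : Fin n) → starAdj u v ≡ starAdj v u
  starAdj-sym F.zero    F.zero    = refl
  starAdj-sym F.zero    (F.suc _) = refl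
  starAdj-sym (F.suc _) F.zero    = refl
  starAdj-sym (F.suc _) (F.suc _) = refl
  starAdj-irrefl : ∀ (v : Fin n) → starAdj v v ≡ false
  starAdj-irrefl F.zero    = refl
  starAdj-irrefl (F.suc _) = refl

Star-connected : ∀ n → Connected (Star n)
Star-connected n F.zero    F.zero    = here
Star-connected n F.zero    (F.suc _) = step refl here
Star-connected n (F.suc _) F.zero    = step refl here
Star-connected n (F.suc _) (F.suc _) = step {w = F.zero} refl (step refl here)

Star-edge : ∀ {n} {u v : Fin (suc n)} → Edge (Star (suc n)) u v → u ≡ F.zero ⊎ v ≡ F.zero
Star-edge {u = F.zero}              _ = inj₁ refl
Star-edge {u = F.suc _} {v = F.zero} _ = inj₂ refl

NonBacktrackingWalk₃ : ∀ {n} → Graph n → Set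
NonBacktrackingWalk₃ {n} G = Σ (Fin n) λ a → Σ (Fin n) λ b → Σ (Fin n) λ c → Σ (Fin n) λ d →
  Edge G a b × Edge G b c × Edge G c d × a ≢ c × b ≢ d

cycle⇒nonBacktrackingWalk₃ : ∀ {n} (G : Graph n) → HasCycle G → NonBacktrackingWalk₃ G
cycle⇒nonBacktrackingWalk₃ G
  (_ , _ , _ , s≤s (s≤s (s≤s _)) , ((a≢b ∷ a≢c ∷ _) ∷ _) , cons ab (cons bc single) , ca) =
  _ , _ , _ , _ , ab , bc , ca , a≢c , λ b≡a → a≢b (sym b≡a)
cycle⇒nonBacktrackingWalk₃ G
  (_ , _ , _ , _ , ((_ ∷ a≢c ∷ _) ∷ (_ ∷ b≢d ∷ _) ∷ _) , cons ab (cons bc (cons cd _)) , _) =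
  _ , _ , _ , _ , ab , bc , cd , a≢c , b≢d

-- Every edge meets the centre: if b were a leaf then a = c = centre, and if b is the centre
-- then c and d are leaves.
Star-acyclic : ∀ n → ¬ HasCycle (Star n)
Star-acyclic zero    (_ , () , _)
Star-acyclic (suc n) cycle with cycle⇒nonBacktrackingWalk₃ (Star (suc n)) cycle
... | _ , _ , _ , _ , ab , bc , cd , a≢c , b≢d with Star-edge ab | Star-edge bc | Star-edge cd
... | inj₁ refl | inj₂ refl | _         = a≢c refl
... | inj₂ refl | _         | inj₁ refl = contradiction bc λ ()
... | inj₂ refl | _         | inj₂ refl = b≢d refl
... | inj₁ refl | inj₁ refl | _         = contradiction ab λ ()

-- The image of the centre has a neighbour y; the leaves cannot be sent to y, so f misses y
-- and, after punching y out, injects Fin (suc n) into Fin n.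
Star-¬Pack : ∀ {n} (G : Graph (suc n)) → (∀ v → ∃[ u ] Edge G v u) → ¬ Pack G (Star (suc n))
Star-¬Pack {n} G hasNeighbour (_ , f , f-injective , f-packs) with hasNeighbour (f F.zero)
... | y , centre~y =
  ℕP.1+n≰n (FP.injective⇒≤ {f = missY} (f-injective ∘ FP.punchOut-injective (y≢f _) (y≢f _)))
  where
  y≢f : ∀ x → y ≢ f x
  y≢f F.zero    refl = contradiction (trans (sym centre~y) (Graph.irrefl G y)) λ ()
  y≢f (F.suc t) refl = contradiction (trans (sym centre~y) (f-packs F.zero (F.suc t) refl)) λ ()
  missY : Fin (suc n) → Fin n
  missY x = F.punchOut (y≢f x)

toℚᵘ-+/1 : ∀ a → toℚᵘ (+ a / 1) ≡ mkℚᵘ (+ a) 0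
toℚᵘ-+/1 a = cong toℚᵘ (QP.normalize-coprime (coprime-sym (1-coprimeTo a)))

+/1-mono-≤ : ∀ {a b} → a ≤ b → + a / 1 Q.≤ + b / 1
+/1-mono-≤ {a} {b} a≤b = QP.toℚᵘ-cancel-≤ (subst₂ U._≤_ (sym (toℚᵘ-+/1 a)) (sym (toℚᵘ-+/1 b))
  (U.*≤* (ℤP.*-monoʳ-≤-nonNeg (+ 1) (ℤ.+≤+ a≤b))))

+/1-homo-+ : ∀ a b → + (a + b) / 1 ≡ + a / 1 Q.+ + b / 1
+/1-homo-+ a b = QP.toℚᵘ-injective (begin
  toℚᵘ (+ (a + b) / 1)               ≡⟨ toℚᵘ-+/1 (a + b) ⟩
  mkℚᵘ (+ (a + b)) 0                 ≈⟨ U.*≡* (cong (ℤ._* + 1) ℤ-identity) ⟩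
  mkℚᵘ (+ a) 0 U.+ mkℚᵘ (+ b) 0      ≡⟨ cong₂ U._+_ (toℚᵘ-+/1 a) (toℚᵘ-+/1 b) ⟨
  toℚᵘ (+ a / 1) U.+ toℚᵘ (+ b / 1)  ≈⟨ QP.toℚᵘ-homo-+ (+ a / 1) (+ b / 1) ⟨
  toℚᵘ (+ a / 1 Q.+ + b / 1)         ∎)
  where
  open UP.≃-Reasoning
  ℤ-identity : + (a + b) ≡ + a ℤ.* + 1 ℤ.+ + b ℤ.* + 1
  ℤ-identity = trans (ℤP.pos-+ a b)
                     (sym (cong₂ ℤ._+_ (ℤP.*-identityʳ (+ a)) (ℤP.*-identityʳ (+ b))))

archimedean : ∀ (ε : ℚ) → 0ℚ Q.< ε → ∀ k N → k * ↧ₙ ε ≤ N → + k / 1 Q.≤ ε Q.* (+ N / 1)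
archimedean (mkℚ (+ 0)    _ _) (*<* (ℤ.+<+ ()))
archimedean (mkℚ -[1+ _ ] _ _) (*<* ())
archimedean ε@(mkℚ +[1+ a ] b _) _ k N k*den≤N = QP.toℚᵘ-cancel-≤ ℚᵘ-bound
  where
  -- The denominator of the ℚᵘ product is suc b * 1, whence the factors 1.
  cross-multiplied : k * suc (b * 1) ≤ suc a * N * 1
  cross-multiplied = begin
    k * suc (b * 1)  ≡⟨ cong (λ d → k * suc d) (ℕP.*-identityʳ b) ⟩
    k * suc b        ≤⟨ k*den≤N ⟩
    N                ≤⟨ ℕP.m≤n*m N (suc a) ⟩
    suc a * N        ≡⟨ ℕP.*-identityʳ (suc a * N) ⟨
    suc a * N * 1    ∎
    where open ℕP.≤-Reasoning
  ℤ-rhs : + (suc a * N * 1) ≡ (+[1+ a ] ℤ.* + N) ℤ.* + 1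
  ℤ-rhs = trans (ℤP.pos-* (suc a * N) 1) (cong (ℤ._* + 1) (ℤP.pos-* (suc a) N))
  ℤ-cross-multiplied : + k ℤ.* + suc (b * 1) ℤ.≤ (+[1+ a ] ℤ.* + N) ℤ.* + 1
  ℤ-cross-multiplied = subst₂ ℤ._≤_ (ℤP.pos-* k _) ℤ-rhs (ℤ.+≤+ cross-multiplied)
  ℚᵘ-bound : toℚᵘ (+ k / 1) U.≤ toℚᵘ (ε Q.* (+ N / 1))
  ℚᵘ-bound = begin
    toℚᵘ (+ k / 1)                    ≡⟨ toℚᵘ-+/1 k ⟩
    mkℚᵘ (+ k) 0                      ≤⟨ U.*≤* ℤ-cross-multiplied ⟩
    mkℚᵘ +[1+ a ] b U.* mkℚᵘ (+ N) 0  ≡⟨ cong (mkℚᵘ +[1+ a ] b U.*_) (toℚᵘ-+/1 N) ⟨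
    toℚᵘ ε U.* toℚᵘ (+ N / 1)         ≃⟨ QP.toℚᵘ-homo-* ε (+ N / 1) ⟨
    toℚᵘ (ε Q.* (+ N / 1))            ∎
    where open UP.≤-Reasoning

[k+L]-2<[1+ε]N : ∀ (ε : ℚ) → 0ℚ Q.< ε → ∀ k L N → L ≤ N → k * ↧ₙ ε ≤ N →
  (+ (k + L) / 1) Q.- (+ 2 / 1) Q.< (1ℚ Q.+ ε) Q.* (+ N / 1)
[k+L]-2<[1+ε]N ε ε>0 k L N L≤N k*den≤N = begin-strict
  + (k + L) / 1 Q.- + 2 / 1  <⟨ QP.+-monoʳ-< (+ (k + L) / 1) (QP.negative⁻¹ (Q.- (+ 2 / 1))) ⟩
  + (k + L) / 1 Q.+ 0ℚ       ≡⟨ QP.+-identityʳ (+ (k + L) / 1) ⟩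
  + (k + L) / 1              ≤⟨ +/1-mono-≤ (ℕP.+-monoʳ-≤ k L≤N) ⟩
  + (k + N) / 1              ≡⟨ +/1-homo-+ k N ⟩
  + k / 1 Q.+ N/1            ≤⟨ QP.+-monoˡ-≤ N/1 (archimedean ε ε>0 k N k*den≤N) ⟩
  ε Q.* N/1 Q.+ N/1          ≡⟨ QP.+-comm (ε Q.* N/1) N/1 ⟩
  N/1 Q.+ ε Q.* N/1          ≡⟨ cong (Q._+ ε Q.* N/1) (QP.*-identityˡ N/1) ⟨
  1ℚ Q.* N/1 Q.+ ε Q.* N/1   ≡⟨ QP.*-distribʳ-+ N/1 1ℚ ε ⟨
  (1ℚ Q.+ ε) Q.* N/1         ∎
  where
  open QP.≤-Reasoning
  N/1 = + N / 1

proposition10 : (ε : ℚ) → 0ℚ < ε → (r : ℕ) → 1 ≤ r →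
    Σ ℕ λ n → Σ (Graph n) λ G → Σ (Graph n) λ T →
    MaxDegreeIs G r × IsTree T ×
    ((+ (3 * r + leaves T) / 1) - (+ 2 / 1) < (1ℚ Data.Rational.+ ε) Data.Rational.* (+ n / 1)) ×
    ¬ Pack G T
proposition10 ε ε>0 r 1≤r =
  n , G , Star n ,
  ((λ v → ℕP.≤-reflexive (regular v)) , (F.zero , regular F.zero)) ,
  (s≤s z≤n , Star-connected n , Star-acyclic n) ,
  [k+L]-2<[1+ε]N ε ε>0 (3 * r) (leaves (Star n)) n (leaves≤ (Star n)) m≤n ,
  Star-¬Pack G (λ v → degree-pos⇒neighbour G v (subst (0 ℕ.<_) (sym (regular v)) 1≤r))
  where
  m = 3 * r * ↧ₙ ε
  n = suc m * suc r
  G = blockCliques (suc r) n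
  regular : ∀ v → degree G v ≡ r
  regular = blockCliques-regular (suc m) r
  m≤n : m ≤ n
  m≤n = ℕP.≤-trans (ℕP.m≤m*n m (suc r)) (ℕP.m≤n+m (m * suc r) (suc r))
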